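{- For every $p\in\mathbb{N}$: $m(c(0,p))=F_{2p}$, $m(c(1,p))=F_{2p+1}$, $m(c(p,p+1))=P_{2p+1}$, and $m(c(p,p))=P_{2p}$, where $F_k$ denotes the $k$-th Fibonacci number ($F_0=0,F_1=1,F_{k+2}=F_{k+1}+F_k$) and $P_k$ the $k$-th Pell number ($P_0=0,P_1=1,P_{k+2}=2P_{k+1}+P_k$).
   Context: Let $A=\begin{pmatrix}1&1\\1&2\end{pmatrix}$, $B=\begin{pmatrix}2&1\\1&1\end{pmatrix}$, and for $w=x_1\cdots x_k\in\{a,b\}^\star$ let $M^w=M^{x_1}\cdots M^{x_k}$ with $M^a=A$, $M^b=B$ ($M^w=I$ for the empty word); $m(w)=\begin{pmatrix}1&0\end{pmatrix}M^w\begin{pmatrix}0\\1\end{pmatrix}$. A word is identified with the lattice path from $(0,0)$ with $a$ = step $(1,0)$, $b$ = step $(0,1)$. For $(d,n)\in\mathbb{N}^2$, $c(n,d)$ is the unique lattice path from $(0,0)$ to $(d,n)$ lying weakly below the segment from $(0,0)$ to $(d,n)$, containing every lattice point of this segment, and such that the region between the path and the segment contains no points of $\mathbb{N}^2$ other than those of the path (equivalently the $\gcd(d,n)$-th power of the lower Christoffel word of slope $n/d$); in particular $c(0,p)=a^p$, $c(1,p)=a^pb$, $c(p,p+1)=a(ab)^p$, $c(p,p)=(ab)^p$. -}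

module Defs where

open import Data.Nat using (ℕ; zero; suc; _+_; _*_; _/_; _≡ᵇ_)
open import Data.Bool using (if_then_else_)
open import Data.List using (List; []; _∷_; applyUpTo)

-- Letters a, b; a word is a list of letters (a = step (1,0), b = step (0,1)).
data Letter : Set where
  a b : Letter

Word : Set
Word = List Letter

record Mat : Set where
  constructor mat
  field
    e11 e12 e21 e22 : ℕ
open Mat public

_⊗_ : Mat → Mat → Mat
mat x11 x12 x21 x22 ⊗ mat y11 y12 y21 y22 =
  mat (x11 * y11 + x12 * y21) (x11 * y12 + x12 * y22)
      (x21 * y11 + x22 * y21) (x21 * y12 + x22 * y22)

I₂ : Mat
I₂ = mat 1 0 0 1

A B : Mat
A = mat 1 1 1 2
B = mat 2 1 1 1

M : Letter → Mat
M a = A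
M b = B

Mw : Word → Mat
Mw [] = I₂
Mw (x ∷ w) = M x ⊗ Mw w

-- m(w) = (1 0) M^w (0 1)^T : the (1,2) entry
m : Word → ℕ
m w = e12 (Mw w)

-- Number of b-steps after k steps of the lower Christoffel path from (0,0)
-- to (d,n): floor(k*n/(n+d)) (the path stays weakly below the segment,
-- as close as possible).
bcount : ℕ → ℕ → ℕ → ℕ
bcount n d k with n + d
... | zero = 0
... | suc s = (k * n) / suc s

letterAt : ℕ → ℕ → ℕ → Letter
letterAt n d i = if bcount n d (suc i) ≡ᵇ bcount n d i then a else b

-- c(n,d): lower Christoffel path from (0,0) to (d,n)
-- (= gcd(d,n)-th power of the lower Christoffel word of slope n/d).
c : ℕ → ℕ → Word
c n d = applyUpTo (letterAt n d) (n + d)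

fib : ℕ → ℕ
fib 0 = 0
fib 1 = 1
fib (suc (suc k)) = fib (suc k) + fib k

pell : ℕ → ℕ
pell 0 = 0
pell 1 = 1
pell (suc (suc k)) = 2 * pell (suc k) + pell k

-- The four paths are aᵖ, aᵖb, a(ab)ᵖ and (ab)ᵖ: along c(p,p) the number of b-steps after
-- k steps is ⌊k/2⌋, and along c(p,p+1) it is ⌊(k-1)/2⌋ for 1 ≤ k ≤ 2p+1.  The second column
-- (e₁₂, e₂₂) of M^w is transformed by left multiplication alone; A moves a pair of consecutive
-- Fibonacci numbers (F_k, F_{k+1}) two steps forward, and AB does the same with the Pell pair
-- (P_k, P_{k+1}) read off as (e₁₂, e₁₂ + e₂₂).
module Submission where

open import Defs
open import Data.Nat using (ℕ; zero; suc; _+_; _*_; _/_; _%_; _≡ᵇ_; _≤_; _<_; s≤s; z≤n; NonZero)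
open import Data.Nat.Properties
open import Data.Nat.DivMod
open import Data.Nat.Divisibility using (divides-refl)
open import Data.Nat.Tactic.RingSolver using (solve-∀)
open import Data.Bool using (if_then_else_)
open import Data.List using ([]; _∷_; _++_; _∷ʳ_; applyUpTo; replicate)
open import Data.List.Properties using (applyUpTo-∷ʳ; ++-identityʳ)
open import Data.Product using (_×_; _,_; proj₁; proj₂)
open import Function using (const)
open import Relation.Binary.PropositionalEquality

[q*n+r]/n≡q : ∀ q {n r} .{{_ : NonZero n}} → r < n → (q * n + r) / n ≡ q
[q*n+r]/n≡q q {n} {r} r<n = begin
  (q * n + r) / n      ≡⟨ +-distrib-/-∣ˡ r (divides-refl q) ⟩
  q * n / n + r / n    ≡⟨ cong₂ _+_ (m*n/n≡m q n) (m<n⇒m/n≡0 r<n) ⟩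
  q + 0                ≡⟨ +-identityʳ q ⟩
  q                    ∎
  where open ≡-Reasoning

bit*n≤n : ∀ {r} n → r < 2 → r * n ≤ n
bit*n≤n n (s≤s z≤n)       = z≤n
bit*n≤n n (s≤s (s≤s z≤n)) = ≤-reflexive (+-identityʳ n)

applyUpTo-cong : ∀ {A : Set} {f g : ℕ → A} n → (∀ i → i < n → f i ≡ g i) →
                 applyUpTo f n ≡ applyUpTo g n
applyUpTo-cong zero    f≗g = refl
applyUpTo-cong (suc n) f≗g =
  cong₂ _∷_ (f≗g 0 (s≤s z≤n)) (applyUpTo-cong n (λ i i<n → f≗g (suc i) (s≤s i<n)))

applyUpTo-const : ∀ {A : Set} (x : A) n → applyUpTo (const x) n ≡ replicate n x
applyUpTo-const x zero    = refl
applyUpTo-const x (suc n) = cong (x ∷_) (applyUpTo-const x n)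

bcount-≡ : ∀ n d k {s q r} → n + d ≡ suc s → k * n ≡ q * suc s + r → r < suc s →
           bcount n d k ≡ q
bcount-≡ n d k {s} {q} n+d≡1+s kn≡qs+r r<1+s with n + d | n+d≡1+s
... | .(suc s) | refl = trans (/-congˡ kn≡qs+r) ([q*n+r]/n≡q q r<1+s)

stepLetter : ℕ → ℕ → Letter
stepLetter x y = if x ≡ᵇ y then a else b

letterAt-≡ : ∀ n d i {x y} → bcount n d (suc i) ≡ x → bcount n d i ≡ y →
             letterAt n d i ≡ stepLetter x y
letterAt-≡ n d i = cong₂ stepLetter

bcount[0,d]≡0 : ∀ d k → bcount 0 d k ≡ 0
bcount[0,d]≡0 zero    k = refl
bcount[0,d]≡0 (suc d) k = bcount-≡ 0 (suc d) k refl (*-zeroʳ k) (s≤s z≤n)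

bcount[1,d]≡0 : ∀ {d k} → k ≤ d → bcount 1 d k ≡ 0
bcount[1,d]≡0 {d} {k} k≤d = bcount-≡ 1 d k refl (*-identityʳ k) (s≤s k≤d)

bcount[1,d][1+d]≡1 : ∀ d → bcount 1 d (suc d) ≡ 1
bcount[1,d][1+d]≡1 d =
  bcount-≡ 1 d (suc d) refl (trans (*-comm (suc d) 1) (sym (+-identityʳ _))) (s≤s z≤n)

bcount[p,p]≡half : ∀ p k → bcount (suc p) (suc p) k ≡ k / 2
bcount[p,p]≡half p k =
  bcount-≡ P P k refl kP≡q[P+P]+rP (≤-<-trans (bit*n≤n P r<2) (m<m+n P (s≤s z≤n)))
  where
  P : ℕ
  P = suc p

  r<2 : k % 2 < 2
  r<2 = m%n<n k 2

  identity : ∀ r q P → (r + q * 2) * P ≡ q * (P + P) + r * P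
  identity = solve-∀

  kP≡q[P+P]+rP : k * P ≡ k / 2 * (P + P) + k % 2 * P
  kP≡q[P+P]+rP = trans (cong (_* P) (m≡m%n+[m/n]*n k 2)) (identity (k % 2) (k / 2) P)

half≤ : ∀ {k p} → k ≤ p + p → k / 2 ≤ p
half≤ {k} {p} k≤p+p = ≤-trans (/-monoˡ-≤ 2 k≤p+p) (≤-reflexive [p+p]/2≡p)
  where
  [p+p]/2≡p : (p + p) / 2 ≡ p
  [p+p]/2≡p = trans (/-congˡ (trans (cong (p +_) (sym (+-identityʳ p))) (*-comm 2 p))) (m*n/n≡m p 2)

-- With k = r + 2q and p = q + t, one has (k+1)p = q(2p+1) + (rp + t) with rp + t ≤ 2p.
bcount[p,1+p]≡half : ∀ p {k} → k ≤ p + p → bcount p (suc p) (suc k) ≡ k / 2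
bcount[p,1+p]≡half p {k} k≤p+p with m≤n⇒∃[o]m+o≡n (half≤ k≤p+p)
... | t , q+t≡p = bcount-≡ p (suc p) (suc k) (+-suc p p) [1+k]p≡q[1+2p]+rem rem<1+2p
  where
  open ≡-Reasoning
  q r : ℕ
  q = k / 2
  r = k % 2

  identity : ∀ r q t → suc (r + q * 2) * (q + t) ≡ q * suc ((q + t) + (q + t)) + (r * (q + t) + t)
  identity = solve-∀

  [1+k]p≡q[1+2p]+rem : suc k * p ≡ q * suc (p + p) + (r * p + t)
  [1+k]p≡q[1+2p]+rem = begin
    suc k * p
      ≡⟨ cong₂ (λ k p → suc k * p) (m≡m%n+[m/n]*n k 2) (sym q+t≡p) ⟩
    suc (r + q * 2) * (q + t)
      ≡⟨ identity r q t ⟩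
    q * suc ((q + t) + (q + t)) + (r * (q + t) + t)
      ≡⟨ cong (λ p → q * suc (p + p) + (r * p + t)) q+t≡p ⟩
    q * suc (p + p) + (r * p + t)
      ∎

  rem<1+2p : r * p + t < suc (p + p)
  rem<1+2p = s≤s (+-mono-≤ (bit*n≤n p (m%n<n k 2)) (subst (t ≤_) q+t≡p (m≤n+m t q)))

abPow : ℕ → Word
abPow zero    = []
abPow (suc p) = a ∷ b ∷ abPow p

alternate : ℕ → Letter
alternate zero          = a
alternate (suc zero)    = b
alternate (suc (suc i)) = alternate i

stepLetter-half : ∀ i → stepLetter (suc i / 2) (i / 2) ≡ alternate i
stepLetter-half zero          = refl
stepLetter-half (suc zero)    = refl
stepLetter-half (suc (suc i)) =
  trans (cong₂ stepLetter (m/n≡1+[m∸n]/n {3 + i} (s≤s (s≤s z≤n)))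
                          (m/n≡1+[m∸n]/n {2 + i} (s≤s (s≤s z≤n))))
        (stepLetter-half i)

applyUpTo-alternate : ∀ p → applyUpTo alternate (p + p) ≡ abPow p
applyUpTo-alternate zero    = refl
applyUpTo-alternate (suc p) = begin
  applyUpTo alternate (suc p + suc p)
    ≡⟨ cong (λ n → a ∷ applyUpTo (λ i → alternate (suc i)) n) (+-suc p p) ⟩
  a ∷ b ∷ applyUpTo alternate (p + p)
    ≡⟨ cong (λ w → a ∷ b ∷ w) (applyUpTo-alternate p) ⟩
  abPow (suc p)
    ∎
  where open ≡-Reasoning

c[0,d]≡aᵈ : ∀ d → c 0 d ≡ replicate d a
c[0,d]≡aᵈ d =
  trans (applyUpTo-cong d (λ i _ → letterAt-≡ 0 d i (bcount[0,d]≡0 d (suc i)) (bcount[0,d]≡0 d i)))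
        (applyUpTo-const a d)

c[1,d]≡aᵈb : ∀ d → c 1 d ≡ replicate d a ++ b ∷ []
c[1,d]≡aᵈb d = begin
  applyUpTo (letterAt 1 d) (suc d)             ≡⟨ applyUpTo-∷ʳ (letterAt 1 d) d ⟨
  applyUpTo (letterAt 1 d) d ∷ʳ letterAt 1 d d ≡⟨ cong₂ _∷ʳ_ aᵈ last ⟩
  replicate d a ∷ʳ b                           ∎
  where
  open ≡-Reasoning
  last : letterAt 1 d d ≡ b
  last = letterAt-≡ 1 d d (bcount[1,d][1+d]≡1 d) (bcount[1,d]≡0 {d} ≤-refl)
  aᵈ : applyUpTo (letterAt 1 d) d ≡ replicate d a
  aᵈ = trans (applyUpTo-cong d (λ i i<d →
                letterAt-≡ 1 d i (bcount[1,d]≡0 i<d) (bcount[1,d]≡0 (<⇒≤ i<d))))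
             (applyUpTo-const a d)

c[p,p]≡[ab]ᵖ : ∀ p → c p p ≡ abPow p
c[p,p]≡[ab]ᵖ zero    = refl
c[p,p]≡[ab]ᵖ (suc p) =
  trans (applyUpTo-cong (suc p + suc p) (λ i _ →
           trans (letterAt-≡ (suc p) (suc p) i (bcount[p,p]≡half p (suc i)) (bcount[p,p]≡half p i))
                 (stepLetter-half i)))
        (applyUpTo-alternate (suc p))

c[p,1+p]≡a[ab]ᵖ : ∀ p → c p (suc p) ≡ a ∷ abPow p
c[p,1+p]≡a[ab]ᵖ p = begin
  applyUpTo (letterAt p (suc p)) (p + suc p)
    ≡⟨ cong (applyUpTo (letterAt p (suc p))) (+-suc p p) ⟩
  letterAt p (suc p) 0 ∷ applyUpTo (λ i → letterAt p (suc p) (suc i)) (p + p)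
    ≡⟨ cong₂ _∷_ first rest ⟩
  a ∷ abPow p
    ∎
  where
  open ≡-Reasoning
  first : letterAt p (suc p) 0 ≡ a
  first = letterAt-≡ p (suc p) 0 (bcount[p,1+p]≡half p z≤n)
                                 (bcount-≡ p (suc p) 0 {q = 0} (+-suc p p) refl (s≤s z≤n))
  rest : applyUpTo (λ i → letterAt p (suc p) (suc i)) (p + p) ≡ abPow p
  rest = trans (applyUpTo-cong (p + p) (λ i i<2p →
                  trans (letterAt-≡ p (suc p) (suc i) (bcount[p,1+p]≡half p i<2p)
                                                      (bcount[p,1+p]≡half p (<⇒≤ i<2p)))
                        (stepLetter-half i)))
               (applyUpTo-alternate p)

e12[A⊗N] : ∀ N → e12 (A ⊗ N) ≡ e12 N + e22 N
e12[A⊗N] (mat _ x _ y) = identity x y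
  where
  identity : ∀ x y → 1 * x + 1 * y ≡ x + y
  identity = solve-∀

FibColumn : ℕ → Mat → Set
FibColumn k N = e12 N ≡ fib k × e22 N ≡ fib (suc k)

PellColumn : ℕ → Mat → Set
PellColumn k N = e12 N ≡ pell k × e12 N + e22 N ≡ pell (suc k)

FibColumn-A⊗ : ∀ k N → FibColumn k N → FibColumn (2 + k) (A ⊗ N)
FibColumn-A⊗ k (mat _ x _ y) (x≡Fₖ , y≡Fₖ₊₁) =
  trans (identity₁ x y) (cong₂ (λ u v → v + u) x≡Fₖ y≡Fₖ₊₁) ,
  trans (identity₂ x y) (cong₂ (λ u v → (v + u) + v) x≡Fₖ y≡Fₖ₊₁)
  where
  identity₁ : ∀ x y → 1 * x + 1 * y ≡ y + x
  identity₁ = solve-∀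
  identity₂ : ∀ x y → 1 * x + 2 * y ≡ (y + x) + y
  identity₂ = solve-∀

PellColumn-AB⊗ : ∀ k N → PellColumn k N → PellColumn (2 + k) (A ⊗ (B ⊗ N))
PellColumn-AB⊗ k (mat _ x _ y) (x≡Pₖ , x+y≡Pₖ₊₁) =
  trans (identity₁ x y) (cong₂ (λ u v → 2 * v + u) x≡Pₖ x+y≡Pₖ₊₁) ,
  trans (identity₂ x y) (cong₂ (λ u v → 2 * (2 * v + u) + v) x≡Pₖ x+y≡Pₖ₊₁)
  where
  -- the left-hand sides are the entries of A ⊗ (B ⊗ N) as the definition of _⊗_ unfolds them
  identity₁ : ∀ x y → 1 * (2 * x + 1 * y) + 1 * (1 * x + 1 * y) ≡ 2 * (x + y) + x
  identity₁ = solve-∀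
  identity₂ : ∀ x y → (1 * (2 * x + 1 * y) + 1 * (1 * x + 1 * y))
                      + (1 * (2 * x + 1 * y) + 2 * (1 * x + 1 * y))
                    ≡ 2 * (2 * (x + y) + x) + (x + y)
  identity₂ = solve-∀

FibColumn-aᵖ : ∀ p {k} w → FibColumn k (Mw w) → FibColumn (2 * p + k) (Mw (replicate p a ++ w))
FibColumn-aᵖ zero    w col = col
FibColumn-aᵖ (suc p) {k} w col =
  subst (λ j → FibColumn (j + k) (Mw (replicate (suc p) a ++ w))) (sym (*-suc 2 p))
        (FibColumn-A⊗ (2 * p + k) (Mw (replicate p a ++ w)) (FibColumn-aᵖ p w col))

PellColumn-[ab]ᵖ : ∀ p → PellColumn (2 * p) (Mw (abPow p))
PellColumn-[ab]ᵖ zero    = refl , refl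
PellColumn-[ab]ᵖ (suc p) =
  subst (λ j → PellColumn j (Mw (abPow (suc p)))) (sym (*-suc 2 p))
        (PellColumn-AB⊗ (2 * p) (Mw (abPow p)) (PellColumn-[ab]ᵖ p))

claim2p6 : (p : ℕ) →
    (m (c 0 p) ≡ fib (2 * p)) ×
    (m (c 1 p) ≡ fib (suc (2 * p))) ×
    (m (c p (suc p)) ≡ pell (suc (2 * p))) ×
    (m (c p p) ≡ pell (2 * p))
claim2p6 p =
  trans (cong m (trans (c[0,d]≡aᵈ p) (sym (++-identityʳ _))))
        (trans (proj₁ (FibColumn-aᵖ p [] (refl , refl))) (cong fib (+-identityʳ (2 * p)))) ,
  trans (cong m (c[1,d]≡aᵈb p))
        (trans (proj₁ (FibColumn-aᵖ p (b ∷ []) (refl , refl))) (cong fib (+-comm (2 * p) 1))) ,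
  trans (cong m (c[p,1+p]≡a[ab]ᵖ p))
        (trans (e12[A⊗N] (Mw (abPow p))) (proj₂ (PellColumn-[ab]ᵖ p))) ,
  trans (cong m (c[p,p]≡[ab]ᵖ p)) (proj₁ (PellColumn-[ab]ᵖ p))
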